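{- Let $1/2<c\le1$, let $G$ be a graph on $n$ vertices with $\delta(G)\ge cn$, let $\chi$ be a proper edge-colouring of $G$, let $t$ be a positive integer with $t\le n/2$, and let $\eta$ be a real number. Let $\mathcal F$ be the set of spanning linear forests of $G$ with exactly $t$ paths, and let $F_0\in\mathcal F$ maximise the number of distinct colours on its edges among all members of $\mathcal F$. Write $F_0=\bigcup_{i=1}^t P_i$ with $P_i=v_1^{(i)}v_2^{(i)}\cdots v_{m_i}^{(i)}$, and let $S=\{v_1^{(1)},\dots,v_1^{(t)}\}$. For $2\le j\le m_i$ put $f(v_j^{(i)})=\chi(v_{j-1}^{(i)}v_j^{(i)})$. Let $C$ be the set of all colours used by $\chi$, let $C_0$ be the set of colours of $C$ not appearing on edges of $F_0$, and for $i=1,\dots,t$ define $$C_i=\{f(x): x\in N_{C_{i-1}}(v_1^{(i)})\setminus S\}\cup C_{i-1},$$ where for a colour set $D$ and a vertex $v$, $N_D(v)=\{u: uv\in E(G),\ \chi(uv)\in D\}$. Suppose that $F_0$ uses fewer than $(c-\eta)n$ distinct colours. Then for every $1\le i\le t$, every $x\in N_{C_{i-1}}(v_1^{(i)})\setminus S$ and every $y\in V(F_0)\setminus(\{x\}\cup S)$, we have $f(x)\ne f(y)$.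
   Context: A linear forest is a graph each of whose components is a path (possibly a single vertex); spanning means it contains all vertices of $G$. A proper edge-colouring assigns different colours to edges sharing a vertex. Each path $P_i$ is given a fixed orientation, with $v_1^{(i)}$ its first vertex; $f$ is defined on all vertices not in $S$.
   Formalization: The parameters c and η are taken in ℚ instead of ℝ. -}

module Defs where

open import Data.Bool using (Bool; true; false; if_then_else_)
open import Data.Nat as ℕ using (ℕ; zero; suc; _<?_)
open import Data.Fin as Fin using (Fin; fromℕ<)
open import Data.List using (List; []; _∷_; length; map; concatMap; tabulate; allFin; deduplicate; foldr)
open import Data.Nat.ListAction using (sum)
open import Data.List.NonEmpty using (List⁺; toList; head)
open import Data.List.Relation.Unary.Linked using (Linked)
open import Data.List.Relation.Binary.Permutation.Propositional using (_↭_)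
open import Data.Maybe using (Maybe; just; nothing; _<∣>_)
open import Data.Product using (Σ; ∃; _×_)
open import Data.Sum using (_⊎_)
open import Relation.Nullary using (¬_; yes; no)
open import Relation.Binary.PropositionalEquality using (_≡_; _≢_)

record Graph (n : ℕ) : Set where
  field
    adj    : Fin n → Fin n → Bool
    sym    : ∀ u v → adj u v ≡ adj v u
    irrefl : ∀ v → adj v v ≡ false

open Graph public

Adj : ∀ {n} → Graph n → Fin n → Fin n → Set
Adj G u v = adj G u v ≡ true

deg : ∀ {n} → Graph n → Fin n → ℕ
deg {n} G v = sum (map (λ u → if adj G v u then 1 else 0) (allFin n))

-- Colours are natural numbers; χ u v is the colour of the edge uv (values on
-- non-edges are irrelevant).
record ProperEdgeColouring {n} (G : Graph n) : Set where
  field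
    col    : Fin n → Fin n → ℕ
    colSym : ∀ u v → Adj G u v → col u v ≡ col v u
    proper : ∀ u v w → Adj G u v → Adj G u w → v ≢ w → col u v ≢ col u w

open ProperEdgeColouring public

-- A spanning linear forest of G with exactly t paths, each path given with a
-- fixed orientation (as a non-empty vertex list; its head is v₁).
record LinForest {n} (G : Graph n) (t : ℕ) : Set where
  field
    path     : Fin t → List⁺ (Fin n)
    isPath   : ∀ i → Linked (Adj G) (toList (path i))
    spanning : concatMap (λ i → toList (path i)) (allFin t) ↭ allFin n

open LinForest public

edgeCols : ∀ {n} → (Fin n → Fin n → ℕ) → List (Fin n) → List ℕ
edgeCols χ []           = []
edgeCols χ (u ∷ [])     = []
edgeCols χ (u ∷ v ∷ xs) = χ u v ∷ edgeCols χ (v ∷ xs)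

forestCols : ∀ {n t} {G : Graph n} → ProperEdgeColouring G → LinForest G t → List ℕ
forestCols {t = t} χ F = concatMap (λ i → edgeCols (col χ) (toList (path F i))) (allFin t)

numCols : ∀ {n t} {G : Graph n} → ProperEdgeColouring G → LinForest G t → ℕ
numCols χ F = length (deduplicate ℕ._≟_ (forestCols χ F))

InS : ∀ {n t} {G : Graph n} → LinForest G t → Fin n → Set
InS {t = t} F x = ∃ λ (i : Fin t) → x ≡ head (path F i)

predAfter : ∀ {n} → Fin n → List (Fin n) → Fin n → Maybe (Fin n)
predAfter u []       x = nothing
predAfter u (v ∷ xs) x with v Fin.≟ x
... | yes _ = just u
... | no  _ = predAfter v xs x

predIn : ∀ {n} → List (Fin n) → Fin n → Maybe (Fin n)
predIn []       x = nothing
predIn (u ∷ xs) x = predAfter u xs x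

predF : ∀ {n t} {G : Graph n} → LinForest G t → Fin n → Maybe (Fin n)
predF {t = t} F x = foldr (λ i r → predIn (toList (path F i)) x <∣> r) nothing (allFin t)

-- f(v_j) = χ(v_{j-1} v_j) for j ≥ 2; undefined (nothing) on S.
fF : ∀ {n t} {G : Graph n} → ProperEdgeColouring G → LinForest G t → Fin n → Maybe ℕ
fF χ F x with predF F x
... | just u  = just (col χ u x)
... | nothing = nothing

InC : ∀ {n} {G : Graph n} → ProperEdgeColouring G → ℕ → Set
InC {G = G} χ a = ∃ λ u → ∃ λ v → Adj G u v × col χ u v ≡ a

InC₀ : ∀ {n t} {G : Graph n} → ProperEdgeColouring G → LinForest G t → ℕ → Set
InC₀ χ F a = InC χ a × ¬ (a ∈ₗ forestCols χ F)
  where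
  open import Data.List.Membership.Propositional renaming (_∈_ to _∈ₗ_)

InN : ∀ {n} {G : Graph n} → ProperEdgeColouring G → (ℕ → Set) → Fin n → Fin n → Set
InN {G = G} χ D v u = Adj G v u × D (col χ v u)

-- Cs k = C_k (k = 0,…,t), with v₁^{(k)} = head of path (k-1) (0-based paths)
Cs : ∀ {n t} {G : Graph n} → ProperEdgeColouring G → LinForest G t → ℕ → ℕ → Set
Cs χ F zero = InC₀ χ F
Cs {t = t} χ F (suc k) with k <? t
... | no  _ = Cs χ F k
... | yes p = λ a → (∃ λ x → InN χ (Cs χ F k) (head (path F (fromℕ< p))) x
                              × ¬ InS F x × fF χ F x ≡ just a)
                    ⊎ Cs χ F k a

{-# OPTIONS --safe #-}
module Submission where

-- Suppose f(x) = f(y).  Delete the F₀-edge entering x and hang the rest of x's path from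
-- v₁⁽ⁱ⁾ by the edge v₁⁽ⁱ⁾x; its colour b lies in C_{i-1}, and the colour f(x) lost with the
-- deleted edge survives on the edge entering y.  If b ∈ C₀, the new spanning linear forest
-- with t paths has more colours than F₀, contradicting maximality.  Otherwise b enters the
-- chain C₀ ⊆ C₁ ⊆ ⋯ at a level d < i through a vertex x′ ∉ S adjacent to v₁⁽ᵈ⁾ with
-- f(x′) = b.  Now b is kept by the new edge, so the edge entering x′ may be deleted and x′
-- hung from v₁⁽ᵈ⁾, and so on.  The levels strictly decrease, so eventually a colour of C₀
-- is gained.  No vertex is hung twice: every hung vertex other than x has its f-colour
-- outside the current level, and x cannot reappear at a level below i by induction on i.

open import Defs renaming (sym to adj-sym)

open import Data.Empty using (⊥; ⊥-elim)
open import Data.Fin as Fin using (Fin; toℕ; fromℕ<)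
open import Data.Fin.Properties using (toℕ-fromℕ<)
open import Data.Integer using (+_)
open import Data.List using (List; []; _∷_; _++_; _∷ʳ_; [_]; concat; concatMap; reverse; length; allFin; deduplicate; foldr)
open import Data.List.Properties using (ʳ++-defn; unfold-reverse; reverse-involutive; ++-assoc; ++-identityʳ; ∷-injectiveˡ; map-cong-local; concatMap-cong)
open import Data.List.Membership.Propositional using (_∈_; _∉_; lose)
open import Data.List.Membership.Propositional.Properties using (∈-∃++; ∈-++⁻; ∈-++⁺ˡ; ∈-++⁺ʳ; ∈-allFin; ∈-concatMap⁺; ∈-concatMap⁻; ∈-deduplicate⁺; ∈-deduplicate⁻)
open import Data.List.NonEmpty using (List⁺; _∷_; toList; head; _++⁺_)
open import Data.List.Relation.Binary.Disjoint.Propositional using (Disjoint)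
open import Data.List.Relation.Binary.Permutation.Propositional using (_↭_; ↭-refl; ↭-reflexive; ↭-sym; ↭-trans; ↭⇒↭ₛ; module PermutationReasoning)
open import Data.List.Relation.Binary.Permutation.Propositional.Properties using (∈-resp-↭; ↭-reverse)
import Data.List.Relation.Binary.Permutation.Propositional.Properties as ↭
import Data.List.Relation.Binary.Permutation.Setoid.Properties as ↭ₛ
open import Data.List.Relation.Binary.Subset.Propositional using (_⊆_)
open import Data.List.Relation.Unary.All as All using (All; []; _∷_)
import Data.List.Relation.Unary.All.Properties as All
open import Data.List.Relation.Unary.Any using (here; there; satisfied)
open import Data.List.Relation.Unary.Linked using (Linked; []; [-]; _∷_)
open import Data.List.Relation.Unary.Unique.Propositional using (Unique; []; _∷_)
open import Data.List.Relation.Unary.Unique.Propositional.Properties using (allFin⁺)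
open import Data.List.Relation.Unary.Unique.DecPropositional.Properties using (deduplicate-!)
open import Data.Maybe using (just; nothing; _<∣>_)
open import Data.Maybe.Properties using (just-injective)
open import Data.Nat as ℕ using (ℕ; zero; suc; _≤_; _<_; z≤n; s≤s; _≤′_; ≤′-refl; ≤′-step; _<?_) renaming (_*_ to _*ℕ_)
open import Data.Nat.Induction using (<-wellFounded)
open import Data.Nat.Properties using (≤-refl; ≤-reflexive; ≤-trans; <-trans; <-≤-trans; <⇒≤; <⇒≱; n≮n; m≤n⇒m≤1+n; ≤⇒≤′)
open import Data.Product using (Σ; ∃; ∃₂; _×_; _,_; proj₁; proj₂)
open import Data.Product.Properties using (≡-dec)
open import Data.Rational using (ℚ; ½; 1ℚ; _/_; _*_; _-_) renaming (_<_ to _<ℚ_; _≤_ to _≤ℚ_)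
open import Data.Sum as Sum using (_⊎_; inj₁; inj₂; [_,_]′)
open import Function using (id)
open import Induction.WellFounded using (Acc; acc)
open import Relation.Binary.Definitions using (DecidableEquality)
open import Relation.Binary.PropositionalEquality using (_≡_; _≢_; refl; sym; trans; cong; cong₂; subst; setoid)
open import Relation.Nullary using (¬_; yes; no)
open import Relation.Nullary.Decidable using (¬¬-excluded-middle)

module _ {A : Set} where

  data Consecutive (u w : A) : List A → Set where
    here  : ∀ {xs} → Consecutive u w (u ∷ w ∷ xs)
    there : ∀ {x xs} → Consecutive u w xs → Consecutive u w (x ∷ xs)

  Consecutive-++⁺ˡ : ∀ {u w xs} ys → Consecutive u w xs → Consecutive u w (xs ++ ys)
  Consecutive-++⁺ˡ ys here      = here
  Consecutive-++⁺ˡ ys (there c) = there (Consecutive-++⁺ˡ ys c)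

  Consecutive-++⁺ʳ : ∀ {u w ys} xs → Consecutive u w ys → Consecutive u w (xs ++ ys)
  Consecutive-++⁺ʳ []       c = c
  Consecutive-++⁺ʳ (x ∷ xs) c = there (Consecutive-++⁺ʳ xs c)

  Consecutive-++⁻ : ∀ {u w x} xs {ys} → Consecutive u w (xs ++ x ∷ ys) → w ≢ x →
                    Consecutive u w xs ⊎ Consecutive u w (x ∷ ys)
  Consecutive-++⁻ []               c         w≢x = inj₂ c
  Consecutive-++⁻ (_ ∷ [])         here      w≢x = ⊥-elim (w≢x refl)
  Consecutive-++⁻ (_ ∷ [])         (there c) w≢x = inj₂ c
  Consecutive-++⁻ (_ ∷ _ ∷ _)      here      w≢x = inj₁ here
  Consecutive-++⁻ (_ ∷ xs@(_ ∷ _)) (there c) w≢x = Sum.map₁ there (Consecutive-++⁻ xs c w≢x)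

  reverse-∷-++ : ∀ (x : A) xs ys → reverse (x ∷ xs) ++ ys ≡ reverse xs ++ x ∷ ys
  reverse-∷-++ x xs ys = trans (sym (ʳ++-defn (x ∷ xs))) (ʳ++-defn xs)

  Consecutive-reverse⁺ : ∀ {u w xs} → Consecutive u w xs → Consecutive w u (reverse xs)
  Consecutive-reverse⁺ {xs = _ ∷ _ ∷ xs} here =
    subst (Consecutive _ _) (sym (ʳ++-defn xs)) (Consecutive-++⁺ʳ (reverse xs) here)
  Consecutive-reverse⁺ {xs = x ∷ xs} (there c) =
    subst (Consecutive _ _) (sym (ʳ++-defn xs)) (Consecutive-++⁺ˡ [ x ] (Consecutive-reverse⁺ c))

  Consecutive-reverse⁻ : ∀ {u w} xs → Consecutive u w (reverse xs) → Consecutive w u xs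
  Consecutive-reverse⁻ xs c = subst (Consecutive _ _) (reverse-involutive xs) (Consecutive-reverse⁺ c)

  Consecutive-∷ʳ-++⁻ : ∀ {u w x y} xs {ys} → Consecutive u w ((xs ∷ʳ x) ++ y ∷ ys) →
                       Consecutive u w (xs ∷ʳ x) ⊎ (u ≡ x × w ≡ y) ⊎ Consecutive u w (y ∷ ys)
  Consecutive-∷ʳ-++⁻ []          here      = inj₂ (inj₁ (refl , refl))
  Consecutive-∷ʳ-++⁻ []          (there c) = inj₂ (inj₂ c)
  Consecutive-∷ʳ-++⁻ (_ ∷ [])    here      = inj₁ here
  Consecutive-∷ʳ-++⁻ (_ ∷ _ ∷ _) here      = inj₁ here
  Consecutive-∷ʳ-++⁻ (_ ∷ xs)    (there c) = Sum.map₁ there (Consecutive-∷ʳ-++⁻ xs c)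

  Consecutive-reverse-++⁻ : ∀ {u w x y} xs {ys} → Consecutive u w (reverse (x ∷ xs) ++ y ∷ ys) →
                            Consecutive w u (x ∷ xs) ⊎ (u ≡ x × w ≡ y) ⊎ Consecutive u w (y ∷ ys)
  Consecutive-reverse-++⁻ {x = x} xs c
    with Consecutive-∷ʳ-++⁻ (reverse xs) (subst (λ zs → Consecutive _ _ (zs ++ _)) (unfold-reverse x xs) c)
  ... | inj₁ c′ = inj₁ (Consecutive-reverse⁻ (x ∷ xs) (subst (Consecutive _ _) (sym (unfold-reverse x xs)) c′))
  ... | inj₂ c′ = inj₂ c′

  Consecutive-reverse-++⁺ : ∀ {x y} xs ys → Consecutive x y (reverse (x ∷ xs) ++ y ∷ ys)
  Consecutive-reverse-++⁺ {x} {y} xs ys =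
    subst (Consecutive _ _) (sym (reverse-∷-++ x xs (y ∷ ys))) (Consecutive-++⁺ʳ (reverse xs) here)

  Consecutive⇒∈ : ∀ {u w x xs} → Consecutive u w (x ∷ xs) → w ∈ xs
  Consecutive⇒∈ here                   = here refl
  Consecutive⇒∈ (there {xs = _ ∷ _} c) = there (Consecutive⇒∈ c)

  ∈⇒Consecutive : ∀ {w x xs} → w ∈ xs → ∃ λ u → Consecutive u w (x ∷ xs)
  ∈⇒Consecutive {x = x} (here refl) = x , here
  ∈⇒Consecutive (there w∈xs) with u , c ← ∈⇒Consecutive w∈xs = u , there c

  module _ {R : A → A → Set} where

    Linked⇒Consecutive⇒R : ∀ {u w xs} → Linked R xs → Consecutive u w xs → R u w
    Linked⇒Consecutive⇒R (r ∷ _)  here      = r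
    Linked⇒Consecutive⇒R (_ ∷ rs) (there c) = Linked⇒Consecutive⇒R rs c

    Consecutive⇒R⇒Linked : ∀ {xs} → (∀ {u w} → Consecutive u w xs → R u w) → Linked R xs
    Consecutive⇒R⇒Linked {[]}         _ = []
    Consecutive⇒R⇒Linked {_ ∷ []}     _ = [-]
    Consecutive⇒R⇒Linked {_ ∷ _ ∷ _} r = r here ∷ Consecutive⇒R⇒Linked (λ c → r (there c))

  Unique-++⁻ˡ : ∀ xs {ys : List A} → Unique (xs ++ ys) → Unique xs
  Unique-++⁻ˡ []       _        = []
  Unique-++⁻ˡ (x ∷ xs) (x∉ ∷ u) = All.++⁻ˡ xs x∉ ∷ Unique-++⁻ˡ xs u

  Unique-++⁻ʳ : ∀ xs {ys : List A} → Unique (xs ++ ys) → Unique ys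
  Unique-++⁻ʳ []       u       = u
  Unique-++⁻ʳ (x ∷ xs) (_ ∷ u) = Unique-++⁻ʳ xs u

  Unique-++⇒Disjoint : ∀ xs {ys : List A} → Unique (xs ++ ys) → Disjoint xs ys
  Unique-++⇒Disjoint (x ∷ xs) (x≢ ∷ _) (here refl  , v∈ys) = All.lookup (All.++⁻ʳ xs x≢) v∈ys refl
  Unique-++⇒Disjoint (x ∷ xs) (_ ∷ u)  (there v∈xs , v∈ys) = Unique-++⇒Disjoint xs u (v∈xs , v∈ys)

  Unique⇒⊆⇒length≤ : ∀ {xs ys : List A} → Unique xs → xs ⊆ ys → length xs ≤ length ys
  Unique⇒⊆⇒length≤ {[]}     _        _     = z≤n
  Unique⇒⊆⇒length≤ {x ∷ xs} (x≢ ∷ u) xs⊆ys with ys₁ , ys₂ , refl ← ∈-∃++ (xs⊆ys (here refl)) =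
    ≤-trans (s≤s (Unique⇒⊆⇒length≤ u xs⊆ys₁++ys₂)) (≤-reflexive (sym (↭.↭-length (↭.shift x ys₁ ys₂))))
    where
    xs⊆ys₁++ys₂ : xs ⊆ ys₁ ++ ys₂
    xs⊆ys₁++ys₂ v∈xs with ∈-++⁻ ys₁ (xs⊆ys (there v∈xs))
    ... | inj₁ v∈ys₁         = ∈-++⁺ˡ v∈ys₁
    ... | inj₂ (here refl)   = ⊥-elim (All.lookup x≢ v∈xs refl)
    ... | inj₂ (there v∈ys₂) = ∈-++⁺ʳ ys₁ v∈ys₂

  module _ (_≟_ : DecidableEquality A) where

    deduplicate-length-< : ∀ {xs ys : List A} {a : A} → xs ⊆ ys → a ∈ ys → a ∉ xs →
                           length (deduplicate _≟_ xs) < length (deduplicate _≟_ ys)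
    deduplicate-length-< {xs} {ys} {a} xs⊆ys a∈ys a∉xs =
      Unique⇒⊆⇒length≤ (All.tabulate a≢ ∷ deduplicate-! _≟_ xs) sub
      where
      a≢ : ∀ {v} → v ∈ deduplicate _≟_ xs → a ≢ v
      a≢ v∈ refl = a∉xs (∈-deduplicate⁻ _≟_ xs v∈)
      sub : a ∷ deduplicate _≟_ xs ⊆ deduplicate _≟_ ys
      sub (here refl) = ∈-deduplicate⁺ _≟_ a∈ys
      sub (there v∈)  = ∈-deduplicate⁺ _≟_ (xs⊆ys (∈-deduplicate⁻ _≟_ xs v∈))

module _ {A B : Set} where

  concatMap-↭ : ∀ {f g : A → List B} → (∀ x → f x ↭ g x) → ∀ xs → concatMap f xs ↭ concatMap g xs
  concatMap-↭ f↭g []       = ↭-refl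
  concatMap-↭ f↭g (x ∷ xs) = ↭.++⁺ (f↭g x) (concatMap-↭ f↭g xs)

  concatMap-extract : ∀ {f g : A → List B} {a ys xs} → Unique xs → a ∈ xs →
                      f a ↭ ys ++ g a → (∀ {x} → x ≢ a → f x ≡ g x) →
                      concatMap f xs ↭ ys ++ concatMap g xs
  concatMap-extract {f} {g} {a} {ys} {_ ∷ xs} (a≢ ∷ _) (here refl) fa↭ agree = begin
    f a ++ concatMap f xs          ↭⟨ ↭.++⁺ʳ _ fa↭ ⟩
    (ys ++ g a) ++ concatMap f xs  ≡⟨ ++-assoc ys (g a) _ ⟩
    ys ++ g a ++ concatMap f xs    ≡⟨ cong (λ zs → ys ++ g a ++ zs) rest ⟩
    ys ++ g a ++ concatMap g xs    ∎
    where
    open PermutationReasoning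
    rest : concatMap f xs ≡ concatMap g xs
    rest = cong concat (map-cong-local (All.map (λ a≢x → agree (λ x≡a → a≢x (sym x≡a))) a≢))
  concatMap-extract {f} {g} {a} {ys} {x ∷ xs} (x≢ ∷ u) (there a∈xs) fa↭ agree = begin
    f x ++ concatMap f xs          ↭⟨ ↭.++⁺ˡ (f x) (concatMap-extract u a∈xs fa↭ agree) ⟩
    f x ++ ys ++ concatMap g xs    ↭⟨ ↭.shifts (f x) ys ⟩
    ys ++ f x ++ concatMap g xs    ≡⟨ cong (λ zs → ys ++ zs ++ concatMap g xs) (agree (All.lookup x≢ a∈xs)) ⟩
    ys ++ g x ++ concatMap g xs    ∎
    where open PermutationReasoning

module _ {I A : Set} (_≟_ : DecidableEquality I) where

  update : (I → A) → I → A → I → A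
  update f i a j with j ≟ i
  ... | yes _ = a
  ... | no  _ = f j

  update-same : ∀ f i a → update f i a i ≡ a
  update-same f i a with i ≟ i
  ... | yes _   = refl
  ... | no  i≢i = ⊥-elim (i≢i refl)

  update-other : ∀ f i a {j} → j ≢ i → update f i a j ≡ f j
  update-other f i a {j} j≢i with j ≟ i
  ... | yes j≡i = ⊥-elim (j≢i j≡i)
  ... | no  _   = refl

  update-agree : ∀ {f g} i a {j} → (j ≢ i → f j ≡ g j) → update f i a j ≡ update g i a j
  update-agree i a {j} agree with j ≟ i
  ... | yes _   = refl
  ... | no  j≢i = agree j≢i

Unique-resp-↭ : ∀ {A : Set} {xs ys : List A} → xs ↭ ys → Unique xs → Unique ys
Unique-resp-↭ {A} p = ↭ₛ.Unique-resp-↭ (setoid A) (↭⇒↭ₛ p)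

toList-++⁺ : ∀ {A : Set} (xs : List A) ys → toList (xs ++⁺ ys) ≡ xs ++ toList ys
toList-++⁺ []       ys = refl
toList-++⁺ (x ∷ xs) ys = cong (x ∷_) (toList-++⁺ xs ys)

Adj-sym : ∀ {n} {G : Graph n} {u w} → Adj G u w → Adj G w u
Adj-sym {G = G} {u} {w} uw = trans (adj-sym G w u) uw

edgeCols-Consecutive : ∀ {n} (χ : Fin n → Fin n → ℕ) {u w xs} → Consecutive u w xs → χ u w ∈ edgeCols χ xs
edgeCols-Consecutive χ here                   = here refl
edgeCols-Consecutive χ (there {xs = _ ∷ _} c) = there (edgeCols-Consecutive χ c)

∈-edgeCols⁻ : ∀ {n} (χ : Fin n → Fin n → ℕ) {c} xs → c ∈ edgeCols χ xs →
              ∃₂ λ u w → Consecutive u w xs × χ u w ≡ c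
∈-edgeCols⁻ χ (u ∷ w ∷ xs) (here c≡χuw) = u , w , here , sym c≡χuw
∈-edgeCols⁻ χ (u ∷ w ∷ xs) (there c∈)
  with u′ , w′ , c′ , eq ← ∈-edgeCols⁻ χ (w ∷ xs) c∈ = u′ , w′ , there c′ , eq

module _ {n t} {G : Graph n} (χ : ProperEdgeColouring G) (F : LinForest G t) where

  forestCols⁺ : ∀ j {u w} → Consecutive u w (toList (path F j)) → col χ u w ∈ forestCols χ F
  forestCols⁺ j c = ∈-concatMap⁺ _ (lose (∈-allFin j) (edgeCols-Consecutive (col χ) c))

  forestCols⁻ : ∀ {c} → c ∈ forestCols χ F →
                ∃₂ λ u w → (∃ λ j → Consecutive u w (toList (path F j))) × col χ u w ≡ c
  forestCols⁻ c∈
    with j , c∈j ← satisfied (∈-concatMap⁻ (λ i → edgeCols (col χ) (toList (path F i))) {xs = allFin t} c∈)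
    with u , w , c , eq ← ∈-edgeCols⁻ (col χ) _ c∈j = u , w , (j , c) , eq

predAfter-∉ : ∀ {n} (z : Fin n) {w} xs → w ∉ xs → predAfter z xs w ≡ nothing
predAfter-∉ z []       w∉ = refl
predAfter-∉ z {w} (v ∷ xs) w∉ with v Fin.≟ w
... | yes refl = ⊥-elim (w∉ (here refl))
... | no  _    = predAfter-∉ v xs (λ w∈ → w∉ (there w∈))

predAfter-Consecutive : ∀ {n} {u w : Fin n} z xs → Unique xs → Consecutive u w (z ∷ xs) →
                        predAfter z xs w ≡ just u
predAfter-Consecutive z (w ∷ xs) _ here with w Fin.≟ w
... | yes _   = refl
... | no  w≢w = ⊥-elim (w≢w refl)
predAfter-Consecutive {w = w} z (v ∷ xs) (v≢ ∷ u) (there c) with v Fin.≟ w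
... | yes refl = ⊥-elim (All.lookup v≢ (Consecutive⇒∈ c) refl)
... | no  _    = predAfter-Consecutive v xs u c

predIn-∉ : ∀ {n} {w : Fin n} xs → w ∉ xs → predIn xs w ≡ nothing
predIn-∉ []       _  = refl
predIn-∉ (z ∷ xs) w∉ = predAfter-∉ z xs (λ w∈ → w∉ (there w∈))

predIn-Consecutive : ∀ {n} {u w : Fin n} {xs} → Unique xs → Consecutive u w xs → predIn xs w ≡ just u
predIn-Consecutive {xs = z ∷ xs} (_ ∷ u) c = predAfter-Consecutive z xs u c

module Reference {n t} {G : Graph n} (χ : ProperEdgeColouring G) (F₀ : LinForest G t) where

  P : Fin t → List (Fin n)
  P j = toList (path F₀ j)

  h : Fin t → Fin n
  h j = head (path F₀ j)

  Edge₀ : Fin n → Fin n → Set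
  Edge₀ u w = ∃ λ j → Consecutive u w (P j)

  Edge₀⇒Adj : ∀ {u w} → Edge₀ u w → Adj G u w
  Edge₀⇒Adj (j , c) = Linked⇒Consecutive⇒R (isPath F₀ j) c

  paths-unique : Unique (concatMap P (allFin t))
  paths-unique = Unique-resp-↭ (↭-sym (spanning F₀)) (allFin⁺ n)

  predF-Edge₀ : ∀ {u w} → Edge₀ u w → predF F₀ w ≡ just u
  predF-Edge₀ {u} {w} (j , c) = go (allFin t) paths-unique (∈-allFin j)
    where
    go : ∀ is → Unique (concatMap P is) → j ∈ is → foldr (λ i r → predIn (P i) w <∣> r) nothing is ≡ just u
    go (i ∷ is) uniq (here refl)  = cong (_<∣> _) (predIn-Consecutive (Unique-++⁻ˡ (P i) uniq) c)
    go (i ∷ is) uniq (there j∈is) = trans (cong (_<∣> _) (predIn-∉ (P i) w∉Pi)) (go is (Unique-++⁻ʳ (P i) uniq) j∈is)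
      where
      w∉Pi : w ∉ P i
      w∉Pi w∈Pi = Unique-++⇒Disjoint (P i) uniq (w∈Pi , ∈-concatMap⁺ P (lose j∈is (there (Consecutive⇒∈ c))))

  fF-Edge₀ : ∀ {u w} → Edge₀ u w → fF χ F₀ w ≡ just (col χ u w)
  fF-Edge₀ {w = w} e with predF F₀ w | predF-Edge₀ e
  ... | just _ | refl = refl

  ∉S⇒Edge₀ : ∀ {w} → ¬ InS F₀ w → ∃ λ u → Edge₀ u w
  ∉S⇒Edge₀ {w} w∉S
    with j , w∈Pj ← satisfied (∈-concatMap⁻ P {xs = allFin t} (∈-resp-↭ (↭-sym (spanning F₀)) (∈-allFin w)))
    with w∈Pj
  ... | here w≡h  = ⊥-elim (w∉S (j , w≡h))
  ... | there w∈ with u , c ← ∈⇒Consecutive w∈ = u , j , c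

  C : ℕ → ℕ → Set
  C = Cs χ F₀

  C-suc : ∀ {k a} → C k a → C (suc k) a
  C-suc {k} c with k <? t
  ... | yes _ = inj₂ c
  ... | no  _ = c

  C-mono : ∀ {j k a} → j ≤ k → C j a → C k a
  C-mono {j} {a = a} j≤k = go (≤⇒≤′ j≤k)
    where
    go : ∀ {k} → j ≤′ k → C j a → C k a
    go ≤′-refl     c = c
    go (≤′-step p) c = C-suc (go p c)

  EntersAt : ℕ → ℕ → Set
  EntersAt zero    a = C zero a
  EntersAt (suc d) a = C (suc d) a × ¬ C d a

  -- C k is not decidable as it stands; since the descent only derives ⊥, a doubly negated
  -- choice of the entry level suffices.
  entry-level : ∀ {k a} → C k a → ¬ ¬ (∃ λ d → d ≤ k × EntersAt d a)
  entry-level {zero}      c no-entry = no-entry (zero , z≤n , c)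
  entry-level {suc k} {a} c no-entry = ¬¬-excluded-middle {A = C k a} λ
    { (yes c′) → entry-level c′ λ (d , d≤k , e) → no-entry (d , m≤n⇒m≤1+n d≤k , e)
    ; (no ¬c′) → no-entry (suc k , ≤-refl , c , ¬c′)
    }

  EntersAt-suc : ∀ {d a} → EntersAt (suc d) a →
                 Σ (d < t) λ d<t → ∃ λ x → InN χ (C d) (h (fromℕ< d<t)) x × ¬ InS F₀ x × fF χ F₀ x ≡ just a
  EntersAt-suc {d} (c , ¬c) with d <? t
  ... | no  _   = ⊥-elim (¬c c)
  ... | yes d<t with c
  ...   | inj₁ new = d<t , new
  ...   | inj₂ old = ⊥-elim (¬c old)

module Surgery {n t} {G : Graph n} (χ : ProperEdgeColouring G) (F₀ : LinForest G t) where

  open Reference χ F₀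

  data Part : Set where
    branch trunk : Part

  _≟ᴾ_ : DecidableEquality Part
  branch ≟ᴾ branch = yes refl
  branch ≟ᴾ trunk  = no λ ()
  trunk  ≟ᴾ branch = no λ ()
  trunk  ≟ᴾ trunk  = yes refl

  Slot : Set
  Slot = Fin t × Part

  _≟ˢ_ : DecidableEquality Slot
  _≟ˢ_ = ≡-dec Fin._≟_ _≟ᴾ_

  -- Path j of the forest under construction is reverse (s (j , branch)) ++ s (j , trunk):
  -- the trunk is an initial segment of the j-th path of F₀, and the branch, a segment of F₀
  -- read in F₀'s direction, hangs from h j by a new edge to its first vertex.
  State : Set
  State = Slot → List (Fin n)

  flat : State → List (Fin n)
  flat s = concatMap (λ j → s (j , branch) ++ s (j , trunk)) (allFin t)

  clear : State → Slot → State
  clear s σ = update _≟ˢ_ s σ []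

  flat-cong : ∀ {s s′} → (∀ σ → s σ ≡ s′ σ) → flat s ≡ flat s′
  flat-cong eq = concatMap-cong (λ j → cong₂ _++_ (eq _) (eq _)) (allFin t)

  flat-extract : ∀ s σ → flat s ↭ s σ ++ flat (clear s σ)
  flat-extract s σ@(m , _) = concatMap-extract (allFin⁺ t) (∈-allFin m) (split σ) agree
    where
    split : ∀ σ → let j = proj₁ σ in
            s (j , branch) ++ s (j , trunk) ↭ s σ ++ (clear s σ (j , branch) ++ clear s σ (j , trunk))
    split (j , branch)
      rewrite update-same _≟ˢ_ s (j , branch) [] | update-other _≟ˢ_ s (j , branch) [] {j , trunk} (λ ())
      = ↭-refl
    split (j , trunk)
      rewrite update-same _≟ˢ_ s (j , trunk) [] | update-other _≟ˢ_ s (j , trunk) [] {j , branch} (λ ())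
      = ↭-trans (↭.++-comm (s (j , branch)) _) (↭-reflexive (cong (s (j , trunk) ++_) (sym (++-identityʳ _))))
    agree : ∀ {j} → j ≢ m → s (j , branch) ++ s (j , trunk) ≡ clear s σ (j , branch) ++ clear s σ (j , trunk)
    agree j≢m = cong₂ _++_ (sym (update-other _≟ˢ_ s σ [] (λ e → j≢m (cong proj₁ e))))
                           (sym (update-other _≟ˢ_ s σ [] (λ e → j≢m (cong proj₁ e))))

  flat-extract₂ : ∀ s {σ τ} → τ ≢ σ → flat s ↭ (s σ ++ s τ) ++ flat (clear (clear s σ) τ)
  flat-extract₂ s {σ} {τ} τ≢σ = begin
    flat s                                            ↭⟨ flat-extract s σ ⟩
    s σ ++ flat (clear s σ)                           ↭⟨ ↭.++⁺ˡ (s σ) (flat-extract (clear s σ) τ) ⟩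
    s σ ++ clear s σ τ ++ flat (clear (clear s σ) τ)  ≡⟨ cong (λ xs → s σ ++ xs ++ flat (clear (clear s σ) τ))
                                                              (update-other _≟ˢ_ s σ [] τ≢σ) ⟩
    s σ ++ s τ ++ flat (clear (clear s σ) τ)          ≡⟨ sym (++-assoc (s σ) (s τ) _) ⟩
    (s σ ++ s τ) ++ flat (clear (clear s σ) τ)        ∎
    where open PermutationReasoning

  flat-move : ∀ {s s′ σ τ} → τ ≢ σ → s′ σ ++ s′ τ ≡ s σ ++ s τ →
              (∀ ρ → ρ ≢ σ → ρ ≢ τ → s′ ρ ≡ s ρ) → flat s′ ↭ flat s
  flat-move {s} {s′} {σ} {τ} τ≢σ moved agree = begin
    flat s′                                        ↭⟨ flat-extract₂ s′ τ≢σ ⟩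
    (s′ σ ++ s′ τ) ++ flat (clear (clear s′ σ) τ)  ≡⟨ cong₂ _++_ moved (flat-cong cleared) ⟩
    (s σ ++ s τ) ++ flat (clear (clear s σ) τ)     ↭⟨ flat-extract₂ s τ≢σ ⟨
    flat s                                         ∎
    where
    open PermutationReasoning
    cleared : ∀ ρ → clear (clear s′ σ) τ ρ ≡ clear (clear s σ) τ ρ
    cleared ρ = update-agree _≟ˢ_ τ [] (λ ρ≢τ → update-agree _≟ˢ_ σ [] (λ ρ≢σ → agree ρ ρ≢σ ρ≢τ))

  ∈-flat⁻ : ∀ {s v} → v ∈ flat s → ∃ λ σ → v ∈ s σ
  ∈-flat⁻ {s} v∈ with j , v∈j ← satisfied (∈-concatMap⁻ (λ j → s (j , branch) ++ s (j , trunk)) {xs = allFin t} v∈)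
    with ∈-++⁻ (s (j , branch)) v∈j
  ... | inj₁ v∈b = (j , branch) , v∈b
  ... | inj₂ v∈t = (j , trunk) , v∈t

  Joint : State → Fin t → Fin n → Set
  Joint s j w = ∃ λ r → s (j , branch) ≡ w ∷ r

  unjoined⇒empty : ∀ {s j} → (∀ {w} → ¬ Joint s j w) → s (j , branch) ≡ []
  unjoined⇒empty {s} {j} unjoined = by-cases (s (j , branch)) refl
    where
    by-cases : ∀ xs → s (j , branch) ≡ xs → s (j , branch) ≡ []
    by-cases []      e = e
    by-cases (w ∷ r) e = ⊥-elim (unjoined (r , e))

  record Good (s : State) : Set where
    field
      trunk-head  : ∀ j → ∃ λ r → s (j , trunk) ≡ h j ∷ r
      piece-Edge₀ : ∀ σ {u w} → Consecutive u w (s σ) → Edge₀ u w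
      joint-adj   : ∀ {j w} → Joint s j w → Adj G (h j) w
      spans       : flat s ↭ allFin n

  data Edge (s : State) : Fin n → Fin n → Set where
    piece : ∀ σ {u w} → Consecutive u w (s σ) → Edge s u w
    joint : ∀ {j w} → Joint s j w → Edge s (h j) w

  initial : State
  initial (j , branch) = []
  initial (j , trunk)  = P j

  initial-good : Good initial
  initial-good = record
    { trunk-head  = λ j → _ , refl
    ; piece-Edge₀ = λ { (j , trunk) c → j , c }
    ; joint-adj   = λ { (_ , ()) }
    ; spans       = spanning F₀
    }

  record Cut (s : State) (l : Fin t) (x : Fin n) : Set where
    field
      result   : State
      good     : Good result
      survives : ∀ {u w} → Edge s u w → w ≢ x → Edge result u w
      joined   : Joint result l x
      joints   : ∀ {j w} → Joint result j w → (j ≡ l × w ≡ x) ⊎ Joint s j w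

  module CutAt {s} (good : Good s) {l : Fin t} {x : Fin n} (empty : s (l , branch) ≡ []) (adj : Adj G (h l) x)
               {σ z A B} (split : s σ ≡ z ∷ A ++ x ∷ B) where

    open Good good

    l≢σ : (l , branch) ≢ σ
    l≢σ refl with () ← trans (sym split) empty

    s′ : State
    s′ = update _≟ˢ_ (update _≟ˢ_ s σ (z ∷ A)) (l , branch) (x ∷ B)

    s′-l : s′ (l , branch) ≡ x ∷ B
    s′-l = update-same _≟ˢ_ _ (l , branch) (x ∷ B)

    s′-σ : s′ σ ≡ z ∷ A
    s′-σ = trans (update-other _≟ˢ_ _ (l , branch) _ (λ e → l≢σ (sym e))) (update-same _≟ˢ_ s σ (z ∷ A))

    s′-other : ∀ {ρ} → ρ ≢ (l , branch) → ρ ≢ σ → s′ ρ ≡ s ρ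
    s′-other ρ≢l ρ≢σ = trans (update-other _≟ˢ_ _ (l , branch) _ ρ≢l) (update-other _≟ˢ_ s σ _ ρ≢σ)

    slot-cases : ∀ ρ → ρ ≡ (l , branch) ⊎ ρ ≡ σ ⊎ (ρ ≢ (l , branch) × ρ ≢ σ)
    slot-cases ρ with ρ ≟ˢ (l , branch) | ρ ≟ˢ σ
    ... | yes ρ≡l | _       = inj₁ ρ≡l
    ... | no  _   | yes ρ≡σ = inj₂ (inj₁ ρ≡σ)
    ... | no  ρ≢l | no  ρ≢σ = inj₂ (inj₂ (ρ≢l , ρ≢σ))

    trunk-head′ : ∀ j → ∃ λ r → s′ (j , trunk) ≡ h j ∷ r
    trunk-head′ j with slot-cases (j , trunk)
    ... | inj₂ (inj₁ refl)      = A , trans s′-σ (cong (_∷ A) (∷-injectiveˡ (trans (sym split) (proj₂ (trunk-head j)))))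
    ... | inj₂ (inj₂ (≢l , ≢σ)) = _ , trans (s′-other ≢l ≢σ) (proj₂ (trunk-head j))

    piece-Edge₀′ : ∀ ρ {u w} → Consecutive u w (s′ ρ) → Edge₀ u w
    piece-Edge₀′ ρ c with slot-cases ρ
    ... | inj₁ refl             = piece-Edge₀ σ (subst (Consecutive _ _) (sym split)
                                    (Consecutive-++⁺ʳ (z ∷ A) (subst (Consecutive _ _) s′-l c)))
    ... | inj₂ (inj₁ refl)      = piece-Edge₀ σ (subst (Consecutive _ _) (sym split)
                                    (Consecutive-++⁺ˡ (x ∷ B) (subst (Consecutive _ _) s′-σ c)))
    ... | inj₂ (inj₂ (≢l , ≢σ)) = piece-Edge₀ ρ (subst (Consecutive _ _) (s′-other ≢l ≢σ) c)

    joints′ : ∀ {j w} → Joint s′ j w → (j ≡ l × w ≡ x) ⊎ Joint s j w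
    joints′ {j} (r , e) with slot-cases (j , branch)
    ... | inj₁ refl             = inj₁ (refl , ∷-injectiveˡ (trans (sym e) s′-l))
    ... | inj₂ (inj₁ refl)      = inj₂ (_ , trans split (cong (_∷ A ++ x ∷ B) (∷-injectiveˡ (trans (sym s′-σ) e))))
    ... | inj₂ (inj₂ (≢l , ≢σ)) = inj₂ (r , trans (sym (s′-other ≢l ≢σ)) e)

    moved : s′ σ ++ s′ (l , branch) ≡ s σ ++ s (l , branch)
    moved rewrite s′-σ | s′-l | split | empty = sym (++-identityʳ _)

    good′ : Good s′
    good′ = record
      { trunk-head  = trunk-head′
      ; piece-Edge₀ = piece-Edge₀′
      ; joint-adj   = λ J → [ (λ { (refl , refl) → adj }) , joint-adj ]′ (joints′ J)
      ; spans       = ↭-trans (flat-move l≢σ moved (λ ρ ρ≢σ ρ≢l → s′-other ρ≢l ρ≢σ)) spans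
      }

    survives′ : ∀ {u w} → Edge s u w → w ≢ x → Edge s′ u w
    survives′ (piece ρ c) w≢x with slot-cases ρ
    ... | inj₁ refl with () ← subst (Consecutive _ _) empty c
    ... | inj₂ (inj₁ refl) = [ (λ c′ → piece σ (subst (Consecutive _ _) (sym s′-σ) c′))
                             , (λ c′ → piece (l , branch) (subst (Consecutive _ _) (sym s′-l) c′)) ]′
                             (Consecutive-++⁻ (z ∷ A) (subst (Consecutive _ _) split c) w≢x)
    ... | inj₂ (inj₂ (≢l , ≢σ)) = piece ρ (subst (Consecutive _ _) (sym (s′-other ≢l ≢σ)) c)
    survives′ (joint {j} (r , e)) _ with slot-cases (j , branch)
    ... | inj₁ refl with () ← trans (sym empty) e
    ... | inj₂ (inj₁ refl)      = joint (A , trans s′-σ (cong (_∷ A) (∷-injectiveˡ (trans (sym split) e))))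
    ... | inj₂ (inj₂ (≢l , ≢σ)) = joint (r , trans (s′-other ≢l ≢σ) e)

    result : Cut s l x
    result = record { result = s′ ; good = good′ ; survives = survives′ ; joined = B , s′-l ; joints = joints′ }

  cut : ∀ {s} → Good s → ∀ {l x} → s (l , branch) ≡ [] → Adj G (h l) x →
        ¬ InS F₀ x → (∀ j → ¬ Joint s j x) → Cut s l x
  cut {s} good {x = x} empty adj x∉S x-unjoined
    with σ , x∈sσ ← ∈-flat⁻ (∈-resp-↭ (↭-sym (Good.spans good)) (∈-allFin x))
    with ∈-∃++ x∈sσ
  ... | z ∷ A , B , split = CutAt.result good empty adj split
  ... | []    , B , split = ⊥-elim (x-first σ split)
    where
    x-first : ∀ σ → s σ ≢ x ∷ B
    x-first (j , branch) e = x-unjoined j (B , e)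
    x-first (j , trunk)  e = x∉S (j , ∷-injectiveˡ (trans (sym e) (proj₂ (Good.trunk-head good j))))

  Carries : State → ℕ → Set
  Carries s c = ∃₂ λ u w → Edge s u w × col χ u w ≡ c

  CarriesAvoiding : State → Fin n → ℕ → Set
  CarriesAvoiding s x c = ∃₂ λ u w → Edge s u w × w ≢ x × col χ u w ≡ c

  Carries⇒≡⊎CarriesAvoiding : ∀ {s x b c} → Good s → (∀ j → ¬ Joint s j x) → fF χ F₀ x ≡ just b →
                              Carries s c → c ≡ b ⊎ CarriesAvoiding s x c
  Carries⇒≡⊎CarriesAvoiding {x = x} good unjoined fx (u , w , e , refl) with w Fin.≟ x
  ... | no  w≢x = inj₂ (u , w , e , w≢x , refl)
  ... | yes refl with e
  ...   | piece σ c = inj₁ (just-injective (trans (sym (fF-Edge₀ (Good.piece-Edge₀ good σ c))) fx))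
  ...   | joint J   = ⊥-elim (unjoined _ J)

  module Assemble {s} (good : Good s) where

    open Good good

    route : Fin t → List (Fin n)
    route j = reverse (s (j , branch)) ++ s (j , trunk)

    Edge⇒Adj : ∀ {u w} → Edge s u w → Adj G u w
    Edge⇒Adj (piece σ c) = Edge₀⇒Adj (piece-Edge₀ σ c)
    Edge⇒Adj (joint J)   = joint-adj J

    route⇒Edge : ∀ j {u w} → Consecutive u w (reverse (s (j , branch)) ++ s (j , trunk)) → Edge s w u ⊎ Edge s u w
    route⇒Edge j c with s (j , branch) in e | trunk-head j
    ... | []    | _ = inj₂ (piece (j , trunk) c)
    ... | v ∷ r | r′ , e′ with Consecutive-reverse-++⁻ r (subst (λ ys → Consecutive _ _ (reverse (v ∷ r) ++ ys)) e′ c)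
    ...   | inj₁ c′                   = inj₁ (piece (j , branch) (subst (Consecutive _ _) (sym e) c′))
    ...   | inj₂ (inj₁ (refl , refl)) = inj₁ (joint (r , e))
    ...   | inj₂ (inj₂ c′)            = inj₂ (piece (j , trunk) (subst (Consecutive _ _) (sym e′) c′))

    Edge⇒route : ∀ {u w} → Edge s u w → ∃ λ j → Consecutive w u (route j) ⊎ Consecutive u w (route j)
    Edge⇒route (piece (j , branch) c) = j , inj₁ (Consecutive-++⁺ˡ _ (Consecutive-reverse⁺ c))
    Edge⇒route (piece (j , trunk) c)  = j , inj₂ (Consecutive-++⁺ʳ (reverse (s (j , branch))) c)
    Edge⇒route (joint {j} (r , e)) with r′ , e′ ← trunk-head j =
      j , inj₁ (subst (λ xs → Consecutive _ _ (reverse xs ++ s (j , trunk))) (sym e)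
                 (subst (λ ys → Consecutive _ _ (reverse (_ ∷ r) ++ ys)) (sym e′) (Consecutive-reverse-++⁺ r r′)))

    route-adj : ∀ j {u w} → Consecutive u w (route j) → Adj G u w
    route-adj j c = [ (λ e → Adj-sym {G = G} (Edge⇒Adj e)) , Edge⇒Adj ]′ (route⇒Edge j c)

    path′ : Fin t → List⁺ (Fin n)
    path′ j = reverse (s (j , branch)) ++⁺ (h j ∷ proj₁ (trunk-head j))

    path′≡route : ∀ j → toList (path′ j) ≡ route j
    path′≡route j = trans (toList-++⁺ (reverse (s (j , branch))) _)
                          (cong (reverse (s (j , branch)) ++_) (sym (proj₂ (trunk-head j))))

    forest : LinForest G t
    forest = record
      { path     = path′
      ; isPath   = λ j → subst (Linked (Adj G)) (sym (path′≡route j)) (Consecutive⇒R⇒Linked (route-adj j))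
      ; spanning = begin
          concatMap (λ j → toList (path′ j)) (allFin t)  ≡⟨ concatMap-cong path′≡route (allFin t) ⟩
          concatMap route (allFin t)                     ↭⟨ concatMap-↭ reverse-branch (allFin t) ⟩
          flat s                                         ↭⟨ spans ⟩
          allFin n                                       ∎
      }
      where
      open PermutationReasoning
      reverse-branch : ∀ j → route j ↭ s (j , branch) ++ s (j , trunk)
      reverse-branch j = ↭.++⁺ʳ (s (j , trunk)) (↭-reverse (s (j , branch)))

    Edge⇒forestCols : ∀ {u w} → Edge s u w → col χ u w ∈ forestCols χ forest
    Edge⇒forestCols e with Edge⇒route e
    ... | j , inj₂ c = forestCols⁺ χ forest j (subst (Consecutive _ _) (sym (path′≡route j)) c)
    ... | j , inj₁ c = subst (_∈ forestCols χ forest) (colSym χ _ _ (route-adj j c))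
                             (forestCols⁺ χ forest j (subst (Consecutive _ _) (sym (path′≡route j)) c))

    gains-colour : ∀ {a} → (∀ {c} → c ∈ forestCols χ F₀ → Carries s c) → Carries s a → a ∉ forestCols χ F₀ →
                   numCols χ F₀ < numCols χ forest
    gains-colour keeps carries-a a∉ = deduplicate-length-< ℕ._≟_ (λ c∈ → carried (keeps c∈)) (carried carries-a) a∉
      where
      carried : ∀ {c} → Carries s c → c ∈ forestCols χ forest
      carried (_ , _ , e , refl) = Edge⇒forestCols e

module Descent {n t} {G : Graph n} (χ : ProperEdgeColouring G) (F₀ : LinForest G t)
               (maximal : ∀ (F : LinForest G t) → numCols χ F ≤ numCols χ F₀)
               (i : Fin t) (x : Fin n)
               (lower : ∀ l → toℕ l < toℕ i → ¬ InN χ (Cs χ F₀ (toℕ l)) (head (path F₀ l)) x) where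

  open Reference χ F₀
  open Surgery χ F₀

  -- The vertices hung so far, and the one about to be hung, are x or have their f-colour
  -- outside C k; the next vertex to be hung has its f-colour inside, so it is not one of them.
  Settled : ℕ → Fin n → Set
  Settled k w = w ≡ x ⊎ ∃ λ a → fF χ F₀ w ≡ just a × ¬ C k a

  Settled-mono : ∀ {k k′ w} → k ≤ k′ → Settled k′ w → Settled k w
  Settled-mono k≤k′ (inj₁ w≡x)             = inj₁ w≡x
  Settled-mono k≤k′ (inj₂ (a , fw , ¬Ca)) = inj₂ (a , fw , λ Ca → ¬Ca (C-mono k≤k′ Ca))

  -- The descent is about to hang v from h l in the state s.
  record Ready (l : Fin t) (v : Fin n) (s : State) : Set where
    field
      good           : Good s
      v∉S            : ¬ InS F₀ v
      v-unjoined     : ∀ j → ¬ Joint s j v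
      v-near         : InN χ (C (toℕ l)) (h l) v
      joints-above   : ∀ {j w} → Joint s j w → toℕ l < toℕ j
      v-settled      : Settled (toℕ l) v
      joints-settled : ∀ {j w} → Joint s j w → Settled (toℕ l) w
      keeps          : ∀ {c} → c ∈ forestCols χ F₀ → CarriesAvoiding s v c
      l≤i            : toℕ l ≤ toℕ i

  module Step {l v s} (ready : Ready l v s) where

    open Ready ready
    open Cut (cut good (unjoined⇒empty {s} {l} (λ J → n≮n _ (joints-above J))) (proj₁ v-near) v∉S v-unjoined)
      renaming (good to good′; result to s′)

    b : ℕ
    b = col χ (h l) v

    settled′ : ∀ {j w} → Joint s′ j w → Settled (toℕ l) w
    settled′ J = [ (λ { (refl , refl) → v-settled }) , joints-settled ]′ (joints J)

    keeps′ : ∀ {c} → c ∈ forestCols χ F₀ → Carries s′ c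
    keeps′ c∈ with u , w , e , w≢v , refl ← keeps c∈ = u , w , survives e w≢v , refl

    new-colour : ¬ EntersAt zero b
    new-colour (_ , b∉F₀) =
      <⇒≱ (Assemble.gains-colour good′ keeps′ (_ , _ , joint joined , refl) b∉F₀) (maximal (Assemble.forest good′))

    next : ∀ {d} → suc d ≤ toℕ l → EntersAt (suc d) b → ∃₂ λ l′ v′ → toℕ l′ < toℕ l × Ready l′ v′ s′
    next {d} d<l enters with d<t , v′ , near′ , v′∉S , fv′ ← EntersAt-suc enters = l′ , v′ , l′<l , ready′
      where
      l′ : Fin t
      l′ = fromℕ< d<t

      |l′|≡d : toℕ l′ ≡ d
      |l′|≡d = toℕ-fromℕ< d<t

      l′<l : toℕ l′ < toℕ l
      l′<l = subst (_< toℕ l) (sym |l′|≡d) d<l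

      unsettled : ¬ Settled (toℕ l) v′
      unsettled (inj₁ refl) = lower l′ (<-≤-trans l′<l l≤i) (subst (λ k → InN χ (C k) (h l′) x) (sym |l′|≡d) near′)
      unsettled (inj₂ (a , fv′≡a , ¬Ca)) with refl ← trans (sym fv′) fv′≡a = ¬Ca (C-mono d<l (proj₁ enters))

      v′-unjoined : ∀ j → ¬ Joint s′ j v′
      v′-unjoined j J = unsettled (settled′ J)

      v≢v′ : v ≢ v′
      v≢v′ refl = v′-unjoined l joined

      ready′ : Ready l′ v′ s′
      ready′ = record
        { good           = good′
        ; v∉S            = v′∉S
        ; v-unjoined     = v′-unjoined
        ; v-near         = subst (λ k → InN χ (C k) (h l′) v′) (sym |l′|≡d) near′
        ; joints-above   = λ J → [ (λ { (refl , _) → l′<l }) , (λ J₀ → <-trans l′<l (joints-above J₀)) ]′ (joints J)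
        ; v-settled      = inj₂ (b , fv′ , subst (λ k → ¬ C k b) (sym |l′|≡d) (proj₂ enters))
        ; joints-settled = λ J → Settled-mono (<⇒≤ l′<l) (settled′ J)
        ; keeps          = λ c∈ → [ (λ { refl → _ , _ , joint joined , v≢v′ , refl }) , id ]′
                                    (Carries⇒≡⊎CarriesAvoiding good′ v′-unjoined fv′ (keeps′ c∈))
        ; l≤i            = ≤-trans (<⇒≤ l′<l) l≤i
        }

  descend : ∀ {l v s} → Acc _<_ (toℕ l) → Ready l v s → ⊥
  descend (acc rec) ready = entry-level (proj₂ (Ready.v-near ready)) λ where
    (zero  , _   , enters) → Step.new-colour ready enters
    (suc d , d<l , enters) → let (_ , _ , l′<l , ready′) = Step.next ready d<l enters
                              in descend (rec l′<l) ready′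

fF-distinct : ∀ {n t} {G : Graph n} (χ : ProperEdgeColouring G) (F₀ : LinForest G t) →
              (∀ (F : LinForest G t) → numCols χ F ≤ numCols χ F₀) →
              ∀ {i : Fin t} {x} → Acc _<_ (toℕ i) →
              InN χ (Cs χ F₀ (toℕ i)) (head (path F₀ i)) x → ¬ InS F₀ x →
              ∀ {y} → y ≢ x → ¬ InS F₀ y → fF χ F₀ x ≢ fF χ F₀ y
fF-distinct χ F₀ maximal {i} {x} (acc rec) near x∉S {y} y≢x y∉S fx≡fy = descend (<-wellFounded (toℕ i)) start
  where
  open Reference χ F₀
  open Surgery χ F₀
  open Descent χ F₀ maximal i x (λ l l<i near′ → fF-distinct χ F₀ maximal (rec l<i) near′ x∉S y≢x y∉S fx≡fy)

  keeps₀ : ∀ {c} → c ∈ forestCols χ F₀ → CarriesAvoiding initial x c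
  keeps₀ c∈ with u , w , (j , uw) , refl ← forestCols⁻ χ F₀ c∈
            with u′ , (j′ , u′y) ← ∉S⇒Edge₀ y∉S
            with Carries⇒≡⊎CarriesAvoiding initial-good (λ _ ()) (trans fx≡fy (fF-Edge₀ (j′ , u′y)))
                   (u , w , piece (j , trunk) uw , refl)
  ... | inj₁ c≡b      = u′ , y , piece (j′ , trunk) u′y , y≢x , sym c≡b
  ... | inj₂ avoiding = avoiding

  start : Ready i x initial
  start = record
    { good           = initial-good
    ; v∉S            = x∉S
    ; v-unjoined     = λ _ ()
    ; v-near         = near
    ; joints-above   = λ ()
    ; v-settled      = inj₁ refl
    ; joints-settled = λ ()
    ; keeps          = keeps₀
    ; l≤i            = ≤-refl
    }

lemma2p2 : (n t : ℕ) (c η : ℚ) (G : Graph n) (χ : ProperEdgeColouring G) →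
    ½ <ℚ c → c ≤ℚ 1ℚ →
    (∀ v → c * (+ n / 1) ≤ℚ (+ deg G v / 1)) →
    1 ≤ t → 2 *ℕ t ≤ n →
    (F₀ : LinForest G t) →
    (∀ (F : LinForest G t) → numCols χ F ≤ numCols χ F₀) →
    (+ numCols χ F₀ / 1) <ℚ (c - η) * (+ n / 1) →
    ∀ (i : Fin t) (x : Fin n) →
    InN χ (Cs χ F₀ (toℕ i)) (head (path F₀ i)) x → ¬ InS F₀ x →
    ∀ (y : Fin n) → y ≢ x → ¬ InS F₀ y →
    fF χ F₀ x ≢ fF χ F₀ y
lemma2p2 n t c η G χ _ _ _ _ _ F₀ maximal _ i x near x∉S y y≢x y∉S =
  fF-distinct χ F₀ maximal (<-wellFounded (toℕ i)) near x∉S y≢x y∉S
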